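{- Let $d\ge 1$ and let $\Delta = \Delta(\mathcal{X})$ be the EM simplex on a family $\mathcal{X}=(X_0,\ldots,X_d)$ of finite sets. Then \[ {\rm Vol}(\Delta) = \frac{1}{d}\left( {\rm SA}(\Delta) + \frac{d+1}{2}\cdot |{\rm Med}(\mathcal{X})| \right), \] where ${\rm SA}(\Delta) = \sum_{i=0}^d {\rm Vol}(\{X_0,\ldots,\widehat{X_i},\ldots,X_d\})$ is the sum of the volumes of the $d+1$ facets of $\Delta$.
   Context: Let $d \geq 0$ and $\mathcal{X} = (X_0, \ldots, X_d)$ a family of finite sets (repetitions allowed; vertices are indexed by $0,\dots,d$). Write $\cup\mathcal{X} = \bigcup_i X_i$ and, for $x \in \cup\mathcal{X}$, $\deg_{\mathcal{X}}(x) = \#\{i : x \in X_i\}$. Let ${\rm Min}(\mathcal{X}), {\rm Med}(\mathcal{X}), {\rm Maj}(\mathcal{X})$ be the sets of $x\in\cup\mathcal{X}$ with $\deg_{\mathcal{X}}(x) <, =, > (d+1)/2$ respectively. The abstract $d$-simplex $\Delta(\mathcal{X})$ has as faces all subsets $\mathcal{F}$ of the vertex set $\{X_0,\dots,X_d\}$ (including $\varnothing$), with $\dim\mathcal{F} = \#\mathcal{F}-1$; a cofacet of $\mathcal{F}$ is a face $\mathcal{G}\supset\mathcal{F}$ with $\#\mathcal{G}=\#\mathcal{F}+1$. Define $\epsilon(x) = \{X_i : x \in X_i\}$ if $x \in {\rm Min}(\mathcal{X})\cup{\rm Med}(\mathcal{X})$ and $\epsilon(x) = \{X_i : x \notin X_i\}$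 if $x\in{\rm Maj}(\mathcal{X})$. Define labelings: for faces with $\dim \mathcal{F}\le\lfloor(d-1)/2\rfloor$, $\lambda^{(0)}(\mathcal{F}) = \{x : \epsilon(x) = \mathcal{F}\}$; for faces with $\dim\mathcal{F} \le \lfloor (d-1)/2\rfloor - (i+1)$, $\lambda^{(i+1)}(\mathcal{F})$ is the multiset union of $\lambda^{(i)}(\mathcal{G})$ over all cofacets $\mathcal{G}$ of $\mathcal{F}$. The EM simplex is $\Delta(\mathcal{X})$ with these labelings. ${\rm Vol}_i(\Delta) = \sum_{\mathcal{F}} |\lambda^{(i)}(\mathcal{F})|$ (multiset cardinalities) over faces with $\dim\mathcal{F}\le\lfloor(d-1)/2\rfloor - i$, and ${\rm Vol}(\Delta) = {\rm Vol}_1(\Delta)$. For a face $\mathcal{F}$, ${\rm Vol}(\mathcal{F})$ is the volume of the EM simplex on the subfamily $\mathcal{F}$ (of dimension $\dim\mathcal{F}$). -}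

module Defs where

open import Data.Bool using (Bool; true; false; not; if_then_else_; _∧_)
import Data.Bool as B
open import Data.Nat using (ℕ; zero; suc; _+_; _*_; _≤ᵇ_; _<ᵇ_; _≡ᵇ_; ⌊_/2⌋)
open import Data.Fin using (Fin; punchIn)
open import Data.Fin.Subset using (Subset; ⁅_⁆; _∪_; ∣_∣)
open import Data.List using (List; []; _∷_; map; filterᵇ; concatMap; length; allFin; _++_)
open import Data.Nat.ListAction using (sum)
open import Data.Vec using (Vec; lookup; tabulate) renaming ([] to []ᵥ; _∷_ to _∷ᵥ_)
open import Data.Vec.Properties using (≡-dec)
open import Relation.Nullary.Decidable using (isYes)

-- A family X = (X_0,…,X_d) of finite sets, all living inside a finite
-- universe Fin n (the union ∪X is finite, so this is no loss of generality).
Family : ℕ → ℕ → Set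
Family d n = Fin (suc d) → Subset n

allSubsets : (m : ℕ) → List (Subset m)
allSubsets zero = []ᵥ ∷ []
allSubsets (suc m) =
  map (true ∷ᵥ_) (allSubsets m) ++ map (false ∷ᵥ_) (allSubsets m)

_==ˢ_ : {m : ℕ} → Subset m → Subset m → Bool
F ==ˢ G = isYes (≡-dec B._≟_ F G)

module EM {d n : ℕ} (X : Family d n) where

  memb : Fin n → Subset (suc d)
  memb x = tabulate (λ i → lookup (X i) x)

  deg : Fin n → ℕ
  deg x = ∣ memb x ∣

  inUnion : Fin n → Bool
  inUnion x = 1 ≤ᵇ deg x

  isMin isMed isMaj : Fin n → Bool
  isMin x = inUnion x ∧ (2 * deg x <ᵇ suc d)
  isMed x = inUnion x ∧ (2 * deg x ≡ᵇ suc d)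
  isMaj x = inUnion x ∧ (suc d <ᵇ 2 * deg x)

  Med : List (Fin n)
  Med = filterᵇ isMed (allFin n)

  ε : Fin n → Subset (suc d)
  ε x = tabulate (λ i → if isMaj x then not (lookup (X i) x) else lookup (X i) x)

  cofacets : Subset (suc d) → List (Subset (suc d))
  cofacets F = map (λ j → F ∪ ⁅ j ⁆)
                   (filterᵇ (λ j → not (lookup F j)) (allFin (suc d)))

  -- labelings λ^(i) (multisets of elements, represented as lists);
  -- only used on faces where the paper defines them (see Volᵢ)
  label : ℕ → Subset (suc d) → List (Fin n)
  label zero F = filterᵇ (λ x → inUnion x ∧ (ε x ==ˢ F)) (allFin n)
  label (suc i) F = concatMap (label i) (cofacets F)

  -- dim F ≤ ⌊(d-1)/2⌋ - i  ⇔  ∣F∣ + i ≤ ⌊(d+1)/2⌋   (dim F = ∣F∣ - 1)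
  inDomain : ℕ → Subset (suc d) → Bool
  inDomain i F = ∣ F ∣ + i ≤ᵇ ⌊ suc d /2⌋

  Volᵢ : ℕ → ℕ
  Volᵢ i = sum (map (λ F → length (label i F))
                    (filterᵇ (inDomain i) (allSubsets (suc d))))

  Vol : ℕ
  Vol = Volᵢ 1

Vol : {d n : ℕ} → Family d n → ℕ
Vol X = EM.Vol X

MedCard : {d n : ℕ} → Family d n → ℕ
MedCard X = length (EM.Med X)

facet : {k n : ℕ} → Family (suc k) n → Fin (suc (suc k)) → Family k n
facet X i j = X (punchIn i j)

SA : {k n : ℕ} → Family (suc k) n → ℕ
SA {k} X = sum (map (λ i → Vol (facet X i)) (allFin (suc (suc k))))

-- Double counting.  An element x of ∪X with ε(x) = E lies in λ⁽¹⁾(F) once for each vertex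
-- j ∉ F with F ∪ {j} = E, i.e. once for each j ∈ E; as |E| = min(deg x, D - deg x) ≤ D/2
-- (D = d + 1), all these faces are in range, so x contributes μ_D(deg x) = min(deg x, D - deg x)
-- to Vol.  The i-th facet sees x with degree deg x - [x ∈ Xᵢ], so SA is a sum over the
-- elements as well, and the theorem reduces to the identity, for a = deg x,
--   2 (D - 1) μ_D(a) = 2 (a μ_{D-1}(a - 1) + (D - a) μ_{D-1}(a)) + D [2a = D].
module Submission where

open import Defs
open import Data.Nat using (ℕ; suc; _+_; _*_)
open import Relation.Binary.PropositionalEquality using (_≡_)

open import Algebra.Bundles using (CommutativeMonoid)
open import Data.Bool using (Bool; true; false; not; _∧_; _∨_; T)
import Data.Bool as B
open import Data.Bool.Properties using (∧-zeroʳ; ∨-identityʳ; ∧-commutativeMonoid)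
open import Data.Fin using (Fin; punchIn) renaming (zero to fzero; suc to fsuc)
open import Data.Fin.Subset using (Subset; ⁅_⁆; _∪_; ∣_∣; ⊥; ∁)
open import Data.Fin.Subset.Properties using (∪-identityʳ; ∣p∣≤n; ∣∁p∣≡n∸∣p∣)
open import Data.List using (List; []; _∷_; map; _++_; filterᵇ; concatMap; length; allFin)
import Data.List as List
open import Data.List.Properties using (map-cong; map-∘; map-++; map-tabulate; length-++)
open import Data.Nat using (zero; pred; _∸_; _⊓_; _≤_; _<_; _≡ᵇ_; _≤ᵇ_; _<ᵇ_; _≟_; ⌊_/2⌋; compare; less; equal; greater; s≤s)
open import Data.Nat.ListAction using (sum)
open import Data.Nat.ListAction.Properties using (sum-++)
open import Data.Nat.Properties
open import Data.Nat.Tactic.RingSolver using (solve-∀)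
open import Data.Product using (_,_)
open import Data.Unit using (tt)
open import Data.Vec using (lookup; tabulate; _[_]≔_) renaming ([] to []ᵥ; _∷_ to _∷ᵥ_)
open import Data.Vec.Properties using (≡-dec; tabulate-∘; lookup∘tabulate)
open import Function using (_∘_)
open import Relation.Nullary.Decidable using (does; isYes≗does; dec-true; dec-false)
open import Relation.Binary.PropositionalEquality using (refl; sym; trans; cong; cong₂; subst; _≗_; ≢-sym; module ≡-Reasoning)
open import Algebra.Properties.CommutativeSemigroup +-commutativeSemigroup using (interchange; x∙yz≈y∙xz)
open import Algebra.Properties.CommutativeSemigroup (CommutativeMonoid.commutativeSemigroup ∧-commutativeMonoid)
  using () renaming (x∙yz≈y∙xz to ∧-left-comm)
open ≡-Reasoning

𝟙 : Bool → ℕ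
𝟙 true = 1
𝟙 false = 0

𝟙-∧ : ∀ a b → 𝟙 (a ∧ b) ≡ 𝟙 a * 𝟙 b
𝟙-∧ true b = sym (+-identityʳ (𝟙 b))
𝟙-∧ false b = refl

T⇒𝟙≡1 : ∀ {b} → T b → 𝟙 b ≡ 1
T⇒𝟙≡1 {true} _ = refl

∑ : {A : Set} → List A → (A → ℕ) → ℕ
∑ xs f = sum (map f xs)

infix 5 ∑
syntax ∑ xs (λ x → e) = ∑[ x ∈ xs ] e

module _ {A : Set} where

  ∑-cong : ∀ {f g : A → ℕ} → f ≗ g → ∀ xs → ∑ xs f ≡ ∑ xs g
  ∑-cong f≗g xs = cong sum (map-cong f≗g xs)

  ∑-0 : ∀ (xs : List A) → ∑[ _ ∈ xs ] 0 ≡ 0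
  ∑-0 [] = refl
  ∑-0 (_ ∷ xs) = ∑-0 xs

  ∑-+ : ∀ (f g : A → ℕ) xs → ∑[ x ∈ xs ] (f x + g x) ≡ ∑ xs f + ∑ xs g
  ∑-+ f g [] = refl
  ∑-+ f g (x ∷ xs) = begin
    f x + g x + (∑[ x ∈ xs ] (f x + g x)) ≡⟨ cong (f x + g x +_) (∑-+ f g xs) ⟩
    f x + g x + (∑ xs f + ∑ xs g)       ≡⟨ interchange (f x) (g x) (∑ xs f) (∑ xs g) ⟩
    f x + ∑ xs f + (g x + ∑ xs g)       ∎

  ∑-*ˡ : ∀ c (f : A → ℕ) xs → ∑[ x ∈ xs ] (c * f x) ≡ c * ∑ xs f
  ∑-*ˡ c f [] = sym (*-zeroʳ c)
  ∑-*ˡ c f (x ∷ xs) = trans (cong (c * f x +_) (∑-*ˡ c f xs)) (sym (*-distribˡ-+ c (f x) _))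

  ∑-filterᵇ : ∀ (p : A → Bool) (f : A → ℕ) xs → ∑ (filterᵇ p xs) f ≡ ∑[ x ∈ xs ] (𝟙 (p x) * f x)
  ∑-filterᵇ p f [] = refl
  ∑-filterᵇ p f (x ∷ xs) with p x
  ... | true  = cong₂ _+_ (sym (+-identityʳ (f x))) (∑-filterᵇ p f xs)
  ... | false = ∑-filterᵇ p f xs

  length-filterᵇ : ∀ (p : A → Bool) xs → length (filterᵇ p xs) ≡ ∑[ x ∈ xs ] 𝟙 (p x)
  length-filterᵇ p [] = refl
  length-filterᵇ p (x ∷ xs) with p x
  ... | true  = cong suc (length-filterᵇ p xs)
  ... | false = length-filterᵇ p xs

  ∑-𝟙∧ : ∀ a (p : A → Bool) (f : A → ℕ) xs → ∑[ x ∈ xs ] 𝟙 (a ∧ p x) * f x ≡ 𝟙 a * (∑[ x ∈ xs ] 𝟙 (p x) * f x)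
  ∑-𝟙∧ true p f xs = sym (+-identityʳ _)
  ∑-𝟙∧ false p f xs = ∑-0 xs

module _ {A B : Set} where

  ∑-map : ∀ (g : A → B) (f : B → ℕ) xs → ∑ (map g xs) f ≡ ∑[ x ∈ xs ] f (g x)
  ∑-map g f xs = cong sum (sym (map-∘ xs))

  length-concatMap : ∀ (f : A → List B) xs → length (concatMap f xs) ≡ ∑[ x ∈ xs ] length (f x)
  length-concatMap f [] = refl
  length-concatMap f (x ∷ xs) = trans (length-++ (f x)) (cong (length (f x) +_) (length-concatMap f xs))

  ∑-comm : ∀ (f : A → B → ℕ) xs ys → ∑[ x ∈ xs ] ∑[ y ∈ ys ] f x y ≡ ∑[ y ∈ ys ] ∑[ x ∈ xs ] f x y
  ∑-comm f [] ys = sym (∑-0 ys)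
  ∑-comm f (x ∷ xs) ys = begin
    ∑ ys (f x) + (∑[ x ∈ xs ] ∑[ y ∈ ys ] f x y) ≡⟨ cong (∑ ys (f x) +_) (∑-comm f xs ys) ⟩
    ∑ ys (f x) + (∑[ y ∈ ys ] ∑[ x ∈ xs ] f x y) ≡⟨ ∑-+ (f x) (λ y → ∑[ x ∈ xs ] f x y) ys ⟨
    ∑[ y ∈ ys ] (f x y + (∑[ x ∈ xs ] f x y)) ∎

∑-allFin-suc : ∀ {m} (f : Fin (suc m) → ℕ) → ∑[ i ∈ allFin (suc m) ] f i ≡ f fzero + (∑[ i ∈ allFin m ] f (fsuc i))
∑-allFin-suc {m} f = cong (f fzero +_) (begin
  sum (map f (List.tabulate fsuc))   ≡⟨ cong sum (map-tabulate fsuc f) ⟩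
  sum (List.tabulate (f ∘ fsuc))     ≡⟨ cong sum (map-tabulate (λ i → i) (f ∘ fsuc)) ⟨
  ∑[ i ∈ allFin m ] f (fsuc i)            ∎)

∑-lookup : ∀ {m} (G : Bool → ℕ) (v : Subset m) → ∑[ i ∈ allFin m ] G (lookup v i) ≡ ∣ v ∣ * G true + (m ∸ ∣ v ∣) * G false
∑-lookup G []ᵥ = refl
∑-lookup {suc m} G (true ∷ᵥ v) = begin
  ∑[ i ∈ allFin (suc m) ] G (lookup (true ∷ᵥ v) i) ≡⟨ ∑-allFin-suc (G ∘ lookup (true ∷ᵥ v)) ⟩
  G true + (∑[ i ∈ allFin m ] G (lookup v i))        ≡⟨ cong (G true +_) (∑-lookup G v) ⟩
  G true + (∣ v ∣ * G true + (m ∸ ∣ v ∣) * G false) ≡⟨ +-assoc (G true) _ _ ⟨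
  suc ∣ v ∣ * G true + (m ∸ ∣ v ∣) * G false        ∎
∑-lookup {suc m} G (false ∷ᵥ v) = begin
  ∑[ i ∈ allFin (suc m) ] G (lookup (false ∷ᵥ v) i) ≡⟨ ∑-allFin-suc (G ∘ lookup (false ∷ᵥ v)) ⟩
  G false + (∑[ i ∈ allFin m ] G (lookup v i))         ≡⟨ cong (G false +_) (∑-lookup G v) ⟩
  G false + (∣ v ∣ * G true + (m ∸ ∣ v ∣) * G false)  ≡⟨ x∙yz≈y∙xz (G false) (∣ v ∣ * G true) _ ⟩
  ∣ v ∣ * G true + (suc (m ∸ ∣ v ∣) * G false)        ≡⟨ cong (λ k → ∣ v ∣ * G true + k * G false) (+-∸-assoc 1 (∣p∣≤n v)) ⟨
  ∣ v ∣ * G true + (suc m ∸ ∣ v ∣) * G false          ∎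

∑-comm₃ : ∀ {A B C : Set} (f : A → B → C → ℕ) xs ys zs →
  ∑[ x ∈ xs ] ∑[ y ∈ ys ] ∑[ z ∈ zs ] f x y z ≡ ∑[ z ∈ zs ] ∑[ y ∈ ys ] ∑[ x ∈ xs ] f x y z
∑-comm₃ f xs ys zs = begin
  ∑[ x ∈ xs ] ∑[ y ∈ ys ] ∑[ z ∈ zs ] f x y z ≡⟨ ∑-comm (λ x y → ∑[ z ∈ zs ] f x y z) xs ys ⟩
  ∑[ y ∈ ys ] ∑[ x ∈ xs ] ∑[ z ∈ zs ] f x y z ≡⟨ ∑-cong (λ y → ∑-comm (λ x z → f x y z) xs zs) ys ⟩
  ∑[ y ∈ ys ] ∑[ z ∈ zs ] ∑[ x ∈ xs ] f x y z ≡⟨ ∑-comm (λ y z → ∑[ x ∈ xs ] f x y z) ys zs ⟩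
  ∑[ z ∈ zs ] ∑[ y ∈ ys ] ∑[ x ∈ xs ] f x y z ∎

private
  core-by-values : ∀ {a c u v w b} → suc a ⊓ c ≡ u → a ⊓ c ≡ v → suc a ⊓ pred c ≡ w → (suc a ≡ᵇ c) ≡ b →
    2 * (a + c) * u ≡ 2 * (suc a * v + c * w) + suc (a + c) * 𝟙 b →
    2 * (a + c) * (suc a ⊓ c) ≡ 2 * (suc a * (a ⊓ c) + c * (suc a ⊓ pred c)) + suc (a + c) * 𝟙 (suc a ≡ᵇ c)
  core-by-values refl refl refl refl eq = eq

μ : ℕ → ℕ → ℕ
μ D a = a ⊓ (D ∸ a)

μ≤⌊/2⌋ : ∀ {D a} → a ≤ D → μ D a ≤ ⌊ D /2⌋
μ≤⌊/2⌋ {D} {a} a≤D = subst (_≤ ⌊ D /2⌋) (sym (n≡⌊n+n/2⌋ (μ D a))) (⌊n/2⌋-mono 2μ≤D)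
  where
  2μ≤D : μ D a + μ D a ≤ D
  2μ≤D = subst (μ D a + μ D a ≤_) (m+[n∸m]≡n a≤D) (+-mono-≤ (m⊓n≤m a (D ∸ a)) (m⊓n≤n a (D ∸ a)))

m+n∸suc[m]≡pred[n] : ∀ m n → m + n ∸ suc m ≡ pred n
m+n∸suc[m]≡pred[n] m n = trans (sym (pred[m∸n]≡m∸[1+n] (m + n) m)) (cong pred (m+n∸m≡n m n))

μ-majority : ∀ D a → (1 ≤ᵇ a) ∧ (D <ᵇ 2 * a) ≡ true → μ D a ≡ D ∸ a
μ-majority D (suc a) maj = m≥n⇒m⊓n≡n (subst (D ∸ suc a ≤_) (+-identityʳ (suc a)) (m≤n+o⇒m∸n≤o D (suc a) (<⇒≤ D<2a)))
  where
  D<2a : D < 2 * suc a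
  D<2a = <ᵇ⇒< D (2 * suc a) (subst T (sym maj) tt)

μ-minority : ∀ D a → (1 ≤ᵇ a) ∧ (D <ᵇ 2 * a) ≡ false → μ D a ≡ a
μ-minority D zero _ = refl
μ-minority D (suc a) min = m≤n⇒m⊓n≡m (m+n≤o⇒m≤o∸n (suc a) (subst (_≤ D) (cong (suc a +_) (+-identityʳ (suc a))) 2a≤D))
  where
  2a≤D : 2 * suc a ≤ D
  2a≤D = ≮⇒≥ (λ D<2a → subst T min (<⇒<ᵇ D<2a))

𝟙[1≤ᵇa]*μ≡μ : ∀ D a → 𝟙 (1 ≤ᵇ a) * μ D a ≡ μ D a
𝟙[1≤ᵇa]*μ≡μ D zero = refl
𝟙[1≤ᵇa]*μ≡μ D (suc a) = +-identityʳ (μ D (suc a))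

+-cancelˡ-≡ᵇ : ∀ m n o → (m + n ≡ᵇ m + o) ≡ (n ≡ᵇ o)
+-cancelˡ-≡ᵇ zero n o = refl
+-cancelˡ-≡ᵇ (suc m) n o = +-cancelˡ-≡ᵇ m n o

≡ᵇ-double : ∀ m n → (2 * m ≡ᵇ m + n) ≡ (m ≡ᵇ n)
≡ᵇ-double m n = trans (+-cancelˡ-≡ᵇ m (m + 0) n) (cong (_≡ᵇ n) (+-identityʳ m))

-- The element has degree suc a and avoids c sets; the cases suc a <, =, > c decide the minima.
μ-recurrence-core : ∀ a c →
  2 * (a + c) * (suc a ⊓ c) ≡ 2 * (suc a * (a ⊓ c) + c * (suc a ⊓ pred c)) + suc (a + c) * 𝟙 (suc a ≡ᵇ c)
μ-recurrence-core a c with compare (suc a) c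
... | less _ k = core-by-values (m≤n⇒m⊓n≡m (<⇒≤ a<c)) (m≤n⇒m⊓n≡m (≤-trans (n≤1+n a) (<⇒≤ a<c)))
                           (m≤n⇒m⊓n≡m (m≤m+n (suc a) k)) (dec-false (suc a ≟ _) (<⇒≢ a<c)) (identity a k)
  where
  a<c : suc a < suc (suc a + k)
  a<c = s≤s (m≤m+n (suc a) k)
  identity : ∀ a k → 2 * (a + suc (suc a + k)) * suc a ≡ 2 * (suc a * a + suc (suc a + k) * suc a) + suc (a + suc (suc a + k)) * 0
  identity = solve-∀
... | equal _ = core-by-values (⊓-idem (suc a)) (m≤n⇒m⊓n≡m (n≤1+n a)) (m≥n⇒m⊓n≡n (n≤1+n a)) (dec-true (suc a ≟ suc a) refl)
                          (identity a)
  where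
  identity : ∀ a → 2 * (a + suc a) * suc a ≡ 2 * (suc a * a + suc a * a) + suc (a + suc a) * 1
  identity = solve-∀
... | greater _ k = core-by-values (m≥n⇒m⊓n≡n (≤-trans (m≤m+n c k) (n≤1+n (c + k)))) (m≥n⇒m⊓n≡n (m≤m+n c k))
                              (m≥n⇒m⊓n≡n (≤-trans (≤-trans pred[n]≤n (m≤m+n c k)) (n≤1+n (c + k))))
                              (dec-false (suc (c + k) ≟ c) (≢-sym (<⇒≢ (s≤s (m≤m+n c k)))))
                              (identity c k)
  where
  identity-suc : ∀ c k → 2 * (suc c + k + suc c) * suc c ≡ 2 * (suc (suc c + k) * suc c + suc c * c) + suc (suc c + k + suc c) * 0
  identity-suc = solve-∀
  identity : ∀ c k → 2 * (c + k + c) * c ≡ 2 * (suc (c + k) * c + c * pred c) + suc (c + k + c) * 0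
  identity zero = solve-∀
  identity (suc c) = identity-suc c

μ-recurrence : ∀ d a → a ≤ suc d →
  2 * d * μ (suc d) a ≡ 2 * (a * μ d (a ∸ 1) + (suc d ∸ a) * μ d a) + suc d * 𝟙 ((1 ≤ᵇ a) ∧ (2 * a ≡ᵇ suc d))
μ-recurrence d zero _ = identity d
  where
  identity : ∀ d → 2 * d * 0 ≡ 2 * (0 + suc d * 0) + suc d * 0
  identity = solve-∀
μ-recurrence d (suc a) (s≤s a≤d) with m≤n⇒∃[o]m+o≡n a≤d
... | c , refl rewrite m+n∸m≡n a c | m+n∸suc[m]≡pred[n] a c | ≡ᵇ-double (suc a) c = μ-recurrence-core a c

==ˢ-∷ : ∀ {m} x y (F G : Subset m) → (x ∷ᵥ F) ==ˢ (y ∷ᵥ G) ≡ does (x B.≟ y) ∧ (F ==ˢ G)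
==ˢ-∷ x y F G = trans (isYes≗does _) (cong (does (x B.≟ y) ∧_) (sym (isYes≗does (≡-dec B._≟_ F G))))

∑-allSubsets-suc : ∀ {m} (f : Subset (suc m) → ℕ) →
  ∑[ F ∈ allSubsets (suc m) ] f F ≡ (∑[ F ∈ allSubsets m ] f (true ∷ᵥ F)) + (∑[ F ∈ allSubsets m ] f (false ∷ᵥ F))
∑-allSubsets-suc {m} f = begin
  sum (map f (map (true ∷ᵥ_) (allSubsets m) ++ map (false ∷ᵥ_) (allSubsets m)))
    ≡⟨ cong sum (map-++ f (map (true ∷ᵥ_) (allSubsets m)) _) ⟩
  sum (map f (map (true ∷ᵥ_) (allSubsets m)) ++ map f (map (false ∷ᵥ_) (allSubsets m)))
    ≡⟨ sum-++ (map f (map (true ∷ᵥ_) (allSubsets m))) _ ⟩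
  ∑ (map (true ∷ᵥ_) (allSubsets m)) f + ∑ (map (false ∷ᵥ_) (allSubsets m)) f
    ≡⟨ cong₂ _+_ (∑-map (true ∷ᵥ_) f (allSubsets m)) (∑-map (false ∷ᵥ_) f (allSubsets m)) ⟩
  (∑[ F ∈ allSubsets m ] f (true ∷ᵥ F)) + (∑[ F ∈ allSubsets m ] f (false ∷ᵥ F)) ∎

∑-allSubsets-==ˢ : ∀ {m} (E : Subset m) (g : Subset m → ℕ) → ∑[ F ∈ allSubsets m ] 𝟙 (E ==ˢ F) * g F ≡ g E
∑-allSubsets-==ˢ []ᵥ g = trans (+-identityʳ _) (+-identityʳ (g []ᵥ))
∑-allSubsets-==ˢ {suc m} (e ∷ᵥ E) g = begin
  ∑[ F ∈ allSubsets (suc m) ] 𝟙 ((e ∷ᵥ E) ==ˢ F) * g F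
    ≡⟨ ∑-allSubsets-suc (λ F → 𝟙 ((e ∷ᵥ E) ==ˢ F) * g F) ⟩
  (∑[ F ∈ allSubsets m ] 𝟙 ((e ∷ᵥ E) ==ˢ (true ∷ᵥ F)) * g (true ∷ᵥ F))
    + (∑[ F ∈ allSubsets m ] 𝟙 ((e ∷ᵥ E) ==ˢ (false ∷ᵥ F)) * g (false ∷ᵥ F))
    ≡⟨ cong₂ _+_ (with-head true) (with-head false) ⟩
  𝟙 (does (e B.≟ true)) * g (true ∷ᵥ E) + 𝟙 (does (e B.≟ false)) * g (false ∷ᵥ E)
    ≡⟨ select e ⟩
  g (e ∷ᵥ E) ∎
  where
  with-head : ∀ b → ∑[ F ∈ allSubsets m ] 𝟙 ((e ∷ᵥ E) ==ˢ (b ∷ᵥ F)) * g (b ∷ᵥ F) ≡ 𝟙 (does (e B.≟ b)) * g (b ∷ᵥ E)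
  with-head b = begin
    ∑[ F ∈ allSubsets m ] 𝟙 ((e ∷ᵥ E) ==ˢ (b ∷ᵥ F)) * g (b ∷ᵥ F)
      ≡⟨ ∑-cong (λ F → cong (λ t → 𝟙 t * g (b ∷ᵥ F)) (==ˢ-∷ e b E F)) (allSubsets m) ⟩
    ∑[ F ∈ allSubsets m ] 𝟙 (does (e B.≟ b) ∧ (E ==ˢ F)) * g (b ∷ᵥ F)
      ≡⟨ ∑-𝟙∧ (does (e B.≟ b)) (E ==ˢ_) (g ∘ (b ∷ᵥ_)) (allSubsets m) ⟩
    𝟙 (does (e B.≟ b)) * (∑[ F ∈ allSubsets m ] 𝟙 (E ==ˢ F) * g (b ∷ᵥ F))
      ≡⟨ cong (𝟙 (does (e B.≟ b)) *_) (∑-allSubsets-==ˢ E (g ∘ (b ∷ᵥ_))) ⟩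
    𝟙 (does (e B.≟ b)) * g (b ∷ᵥ E) ∎
  select : ∀ e → 𝟙 (does (e B.≟ true)) * g (true ∷ᵥ E) + 𝟙 (does (e B.≟ false)) * g (false ∷ᵥ E) ≡ g (e ∷ᵥ E)
  select true = trans (+-identityʳ _) (+-identityʳ _)
  select false = +-identityʳ _

cofacet-indicator : ∀ {m} (F E : Subset m) j →
  not (lookup F j) ∧ (E ==ˢ (F ∪ ⁅ j ⁆)) ≡ lookup E j ∧ ((E [ j ]≔ false) ==ˢ F)
cofacet-indicator (true ∷ᵥ F) (e ∷ᵥ E) fzero = begin
  false                                     ≡⟨ ∧-zeroʳ e ⟨
  e ∧ false                                 ≡⟨ cong (e ∧_) (==ˢ-∷ false true E F) ⟨
  e ∧ ((false ∷ᵥ E) ==ˢ (true ∷ᵥ F))         ∎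
cofacet-indicator (false ∷ᵥ F) (e ∷ᵥ E) fzero = begin
  (e ∷ᵥ E) ==ˢ (true ∷ᵥ (F ∪ ⊥))               ≡⟨ ==ˢ-∷ e true E (F ∪ ⊥) ⟩
  does (e B.≟ true) ∧ (E ==ˢ (F ∪ ⊥))         ≡⟨ cong (does (e B.≟ true) ∧_) (cong (E ==ˢ_) (∪-identityʳ F)) ⟩
  does (e B.≟ true) ∧ (E ==ˢ F)             ≡⟨ cong (_∧ (E ==ˢ F)) (head-true e) ⟩
  e ∧ (E ==ˢ F)                             ≡⟨ cong (e ∧_) (==ˢ-∷ false false E F) ⟨
  e ∧ ((false ∷ᵥ E) ==ˢ (false ∷ᵥ F))        ∎
  where
  head-true : ∀ e → does (e B.≟ true) ≡ e
  head-true true = refl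
  head-true false = refl
cofacet-indicator (f ∷ᵥ F) (e ∷ᵥ E) (fsuc j) = begin
  not (lookup F j) ∧ ((e ∷ᵥ E) ==ˢ ((f ∨ false) ∷ᵥ (F ∪ ⁅ j ⁆)))
    ≡⟨ cong (λ b → not (lookup F j) ∧ ((e ∷ᵥ E) ==ˢ (b ∷ᵥ (F ∪ ⁅ j ⁆)))) (∨-identityʳ f) ⟩
  not (lookup F j) ∧ ((e ∷ᵥ E) ==ˢ (f ∷ᵥ (F ∪ ⁅ j ⁆)))
    ≡⟨ cong (not (lookup F j) ∧_) (==ˢ-∷ e f E _) ⟩
  not (lookup F j) ∧ (does (e B.≟ f) ∧ (E ==ˢ (F ∪ ⁅ j ⁆)))
    ≡⟨ ∧-left-comm (not (lookup F j)) (does (e B.≟ f)) _ ⟩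
  does (e B.≟ f) ∧ (not (lookup F j) ∧ (E ==ˢ (F ∪ ⁅ j ⁆)))
    ≡⟨ cong (does (e B.≟ f) ∧_) (cofacet-indicator F E j) ⟩
  does (e B.≟ f) ∧ (lookup E j ∧ ((E [ j ]≔ false) ==ˢ F))
    ≡⟨ ∧-left-comm (does (e B.≟ f)) (lookup E j) _ ⟩
  lookup E j ∧ (does (e B.≟ f) ∧ ((E [ j ]≔ false) ==ˢ F))
    ≡⟨ cong (lookup E j ∧_) (==ˢ-∷ e f _ F) ⟨
  lookup E j ∧ ((e ∷ᵥ (E [ j ]≔ false)) ==ˢ (f ∷ᵥ F)) ∎

∑-cofacets : ∀ {m} (E : Subset m) j (h : Subset m → ℕ) →
  ∑[ F ∈ allSubsets m ] 𝟙 (not (lookup F j) ∧ (E ==ˢ (F ∪ ⁅ j ⁆))) * h F ≡ 𝟙 (lookup E j) * h (E [ j ]≔ false)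
∑-cofacets {m} E j h = begin
  ∑[ F ∈ allSubsets m ] 𝟙 (not (lookup F j) ∧ (E ==ˢ (F ∪ ⁅ j ⁆))) * h F
    ≡⟨ ∑-cong (λ F → cong (λ b → 𝟙 b * h F) (cofacet-indicator F E j)) (allSubsets m) ⟩
  ∑[ F ∈ allSubsets m ] 𝟙 (lookup E j ∧ ((E [ j ]≔ false) ==ˢ F)) * h F
    ≡⟨ ∑-𝟙∧ (lookup E j) ((E [ j ]≔ false) ==ˢ_) h (allSubsets m) ⟩
  𝟙 (lookup E j) * (∑[ F ∈ allSubsets m ] 𝟙 ((E [ j ]≔ false) ==ˢ F) * h F)
    ≡⟨ cong (𝟙 (lookup E j) *_) (∑-allSubsets-==ˢ (E [ j ]≔ false) h) ⟩
  𝟙 (lookup E j) * h (E [ j ]≔ false) ∎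

∣p[i]≔outside∣ : ∀ {m} (E : Subset m) j → lookup E j ≡ true → suc ∣ E [ j ]≔ false ∣ ≡ ∣ E ∣
∣p[i]≔outside∣ (true ∷ᵥ E) fzero _ = refl
∣p[i]≔outside∣ (true ∷ᵥ E) (fsuc j) eq = cong suc (∣p[i]≔outside∣ E j eq)
∣p[i]≔outside∣ (false ∷ᵥ E) (fsuc j) eq = ∣p[i]≔outside∣ E j eq

∣tabulate∘punchIn∣ : ∀ {m} (f : Fin (suc m) → Bool) i → ∣ tabulate (f ∘ punchIn i) ∣ + 𝟙 (f i) ≡ ∣ tabulate f ∣
∣tabulate∘punchIn∣ f fzero with f fzero
... | true = +-comm _ 1
... | false = +-identityʳ _
∣tabulate∘punchIn∣ {suc m} f (fsuc i) with f fzero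
... | true = cong suc (∣tabulate∘punchIn∣ (f ∘ fsuc) i)
... | false = ∣tabulate∘punchIn∣ (f ∘ fsuc) i

module _ {d n : ℕ} (X : Family d n) where
  open EM X hiding (Vol)

  private
    vertices : List (Fin (suc d))
    vertices = allFin (suc d)
    points : List (Fin n)
    points = allFin n
    faces : List (Subset (suc d))
    faces = allSubsets (suc d)

  ∣ε∣≡μ : ∀ x → ∣ ε x ∣ ≡ μ (suc d) (deg x)
  ∣ε∣≡μ x with isMaj x in maj
  ... | true = begin
    ∣ tabulate (λ i → not (lookup (X i) x)) ∣ ≡⟨ cong ∣_∣ (tabulate-∘ not (λ i → lookup (X i) x)) ⟩
    ∣ ∁ (memb x) ∣                            ≡⟨ ∣∁p∣≡n∸∣p∣ (memb x) ⟩
    suc d ∸ deg x                             ≡⟨ μ-majority (suc d) (deg x) maj ⟨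
    μ (suc d) (deg x)                         ∎
  ... | false = sym (μ-minority (suc d) (deg x) maj)

  cofacet-count : ∀ E → ∑[ j ∈ vertices ] ∑[ F ∈ faces ] 𝟙 (not (lookup F j) ∧ (E ==ˢ (F ∪ ⁅ j ⁆))) * 𝟙 (inDomain 1 F)
                        ≡ ∣ E ∣ * 𝟙 (∣ E ∣ ≤ᵇ ⌊ suc d /2⌋)
  cofacet-count E = begin
    ∑[ j ∈ vertices ] ∑[ F ∈ faces ] 𝟙 (not (lookup F j) ∧ (E ==ˢ (F ∪ ⁅ j ⁆))) * 𝟙 (inDomain 1 F)
      ≡⟨ ∑-cong (λ j → ∑-cofacets E j (𝟙 ∘ inDomain 1)) vertices ⟩
    ∑[ j ∈ vertices ] 𝟙 (lookup E j) * 𝟙 (inDomain 1 (E [ j ]≔ false))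
      ≡⟨ ∑-cong removed-in-domain vertices ⟩
    ∑[ j ∈ vertices ] 𝟙 (lookup E j) * c
      ≡⟨ ∑-lookup (λ b → 𝟙 b * c) E ⟩
    ∣ E ∣ * (1 * c) + (suc d ∸ ∣ E ∣) * (0 * c)
      ≡⟨ simplify ∣ E ∣ (suc d ∸ ∣ E ∣) c ⟩
    ∣ E ∣ * c ∎
    where
    c : ℕ
    c = 𝟙 (∣ E ∣ ≤ᵇ ⌊ suc d /2⌋)
    removed-in-domain : ∀ j → 𝟙 (lookup E j) * 𝟙 (inDomain 1 (E [ j ]≔ false)) ≡ 𝟙 (lookup E j) * c
    removed-in-domain j with lookup E j in j∈E
    ... | true = cong (λ k → 1 * 𝟙 (k ≤ᵇ ⌊ suc d /2⌋)) (trans (+-comm _ 1) (∣p[i]≔outside∣ E j j∈E))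
    ... | false = refl
    simplify : ∀ a b c → a * (1 * c) + b * (0 * c) ≡ a * c
    simplify = solve-∀

  length-label₁ : ∀ F → length (label 1 F)
    ≡ ∑[ j ∈ vertices ] ∑[ x ∈ points ] 𝟙 (not (lookup F j)) * 𝟙 (inUnion x ∧ (ε x ==ˢ (F ∪ ⁅ j ⁆)))
  length-label₁ F = begin
    length (concatMap (label 0) (cofacets F))
      ≡⟨ length-concatMap (label 0) (cofacets F) ⟩
    ∑[ G ∈ cofacets F ] length (label 0 G)
      ≡⟨ ∑-map (λ j → F ∪ ⁅ j ⁆) (length ∘ label 0) (filterᵇ (not ∘ lookup F) vertices) ⟩
    ∑[ j ∈ filterᵇ (not ∘ lookup F) vertices ] length (label 0 (F ∪ ⁅ j ⁆))
      ≡⟨ ∑-filterᵇ (not ∘ lookup F) (λ j → length (label 0 (F ∪ ⁅ j ⁆))) vertices ⟩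
    ∑[ j ∈ vertices ] 𝟙 (not (lookup F j)) * length (label 0 (F ∪ ⁅ j ⁆))
      ≡⟨ ∑-cong (λ j → trans (cong (𝟙 (not (lookup F j)) *_) (length-filterᵇ _ points)) (sym (∑-*ˡ (𝟙 (not (lookup F j))) (λ x → 𝟙 (inUnion x ∧ (ε x ==ˢ (F ∪ ⁅ j ⁆)))) points))) vertices ⟩
    ∑[ j ∈ vertices ] ∑[ x ∈ points ] 𝟙 (not (lookup F j)) * 𝟙 (inUnion x ∧ (ε x ==ˢ (F ∪ ⁅ j ⁆))) ∎

  Vol≡∑μ : Vol X ≡ ∑[ x ∈ points ] μ (suc d) (deg x)
  Vol≡∑μ = begin
    Vol X
      ≡⟨ ∑-filterᵇ (inDomain 1) (length ∘ label 1) faces ⟩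
    ∑[ F ∈ faces ] 𝟙 (inDomain 1 F) * length (label 1 F)
      ≡⟨ ∑-cong (λ F → cong (𝟙 (inDomain 1 F) *_) (length-label₁ F)) faces ⟩
    ∑[ F ∈ faces ] 𝟙 (inDomain 1 F) * (∑[ j ∈ vertices ] ∑[ x ∈ points ] term F j x)
      ≡⟨ ∑-cong (λ F → trans (sym (∑-*ˡ (𝟙 (inDomain 1 F)) (λ j → ∑[ x ∈ points ] term F j x) vertices))
                                (∑-cong (λ j → sym (∑-*ˡ (𝟙 (inDomain 1 F)) (term F j) points)) vertices)) faces ⟩
    ∑[ F ∈ faces ] ∑[ j ∈ vertices ] ∑[ x ∈ points ] 𝟙 (inDomain 1 F) * term F j x
      ≡⟨ ∑-comm₃ (λ F j x → 𝟙 (inDomain 1 F) * term F j x) faces vertices points ⟩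
    ∑[ x ∈ points ] ∑[ j ∈ vertices ] ∑[ F ∈ faces ] 𝟙 (inDomain 1 F) * term F j x
      ≡⟨ ∑-cong contribution points ⟩
    ∑[ x ∈ points ] μ (suc d) (deg x) ∎
    where
    term : Subset (suc d) → Fin (suc d) → Fin n → ℕ
    term F j x = 𝟙 (not (lookup F j)) * 𝟙 (inUnion x ∧ (ε x ==ˢ (F ∪ ⁅ j ⁆)))
    cofacet-term : Fin n → Fin (suc d) → Subset (suc d) → ℕ
    cofacet-term x j F = 𝟙 (not (lookup F j) ∧ (ε x ==ˢ (F ∪ ⁅ j ⁆))) * 𝟙 (inDomain 1 F)
    reassoc : ∀ a b u e → a * (b * (u * e)) ≡ u * (b * e * a)
    reassoc = solve-∀
    factor : ∀ x j F → 𝟙 (inDomain 1 F) * term F j x ≡ 𝟙 (inUnion x) * cofacet-term x j F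
    factor x j F = begin
      _ ≡⟨ cong (λ t → 𝟙 (inDomain 1 F) * (𝟙 (not (lookup F j)) * t)) (𝟙-∧ (inUnion x) _) ⟩
      _ ≡⟨ reassoc (𝟙 (inDomain 1 F)) (𝟙 (not (lookup F j))) (𝟙 (inUnion x)) _ ⟩
      _ ≡⟨ cong (λ t → 𝟙 (inUnion x) * (t * 𝟙 (inDomain 1 F))) (𝟙-∧ (not (lookup F j)) _) ⟨
      _ ∎
    contribution : ∀ x → ∑[ j ∈ vertices ] ∑[ F ∈ faces ] 𝟙 (inDomain 1 F) * term F j x ≡ μ (suc d) (deg x)
    contribution x = begin
      ∑[ j ∈ vertices ] ∑[ F ∈ faces ] 𝟙 (inDomain 1 F) * term F j x
        ≡⟨ ∑-cong (λ j → trans (∑-cong (factor x j) faces) (∑-*ˡ (𝟙 (inUnion x)) (cofacet-term x j) faces)) vertices ⟩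
      ∑[ j ∈ vertices ] 𝟙 (inUnion x) * (∑[ F ∈ faces ] cofacet-term x j F)
        ≡⟨ ∑-*ˡ (𝟙 (inUnion x)) (λ j → ∑[ F ∈ faces ] cofacet-term x j F) vertices ⟩
      𝟙 (inUnion x) * (∑[ j ∈ vertices ] ∑[ F ∈ faces ] cofacet-term x j F)
        ≡⟨ cong (𝟙 (inUnion x) *_) (cofacet-count (ε x)) ⟩
      𝟙 (inUnion x) * (∣ ε x ∣ * 𝟙 (∣ ε x ∣ ≤ᵇ ⌊ suc d /2⌋))
        ≡⟨ cong (λ e → 𝟙 (inUnion x) * (e * 𝟙 (e ≤ᵇ ⌊ suc d /2⌋))) (∣ε∣≡μ x) ⟩
      𝟙 (inUnion x) * (μ (suc d) (deg x) * 𝟙 (μ (suc d) (deg x) ≤ᵇ ⌊ suc d /2⌋))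
        ≡⟨ cong (λ t → 𝟙 (inUnion x) * (μ (suc d) (deg x) * t)) (T⇒𝟙≡1 (≤⇒≤ᵇ (μ≤⌊/2⌋ (∣p∣≤n (memb x))))) ⟩
      𝟙 (inUnion x) * (μ (suc d) (deg x) * 1)
        ≡⟨ cong (𝟙 (inUnion x) *_) (*-identityʳ _) ⟩
      𝟙 (inUnion x) * μ (suc d) (deg x)
        ≡⟨ 𝟙[1≤ᵇa]*μ≡μ (suc d) (deg x) ⟩
      μ (suc d) (deg x) ∎

module _ {k n : ℕ} (X : Family (suc k) n) where
  open EM X using (deg; memb)

  private
    vertices : List (Fin (suc (suc k)))
    vertices = allFin (suc (suc k))
    points : List (Fin n)
    points = allFin n

  deg-facet : ∀ i x → EM.deg (facet X i) x ≡ deg x ∸ 𝟙 (lookup (X i) x)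
  deg-facet i x = begin
    EM.deg (facet X i) x                                        ≡⟨ m+n∸n≡m _ (𝟙 (lookup (X i) x)) ⟨
    EM.deg (facet X i) x + 𝟙 (lookup (X i) x) ∸ 𝟙 (lookup (X i) x) ≡⟨ cong (_∸ 𝟙 (lookup (X i) x)) (∣tabulate∘punchIn∣ (λ i → lookup (X i) x) i) ⟩
    deg x ∸ 𝟙 (lookup (X i) x)                                  ∎

  ∑-facets-μ : ∀ x → ∑[ i ∈ vertices ] μ (suc k) (EM.deg (facet X i) x)
                     ≡ deg x * μ (suc k) (deg x ∸ 1) + (suc (suc k) ∸ deg x) * μ (suc k) (deg x)
  ∑-facets-μ x = begin
    ∑[ i ∈ vertices ] μ (suc k) (EM.deg (facet X i) x)
      ≡⟨ ∑-cong (λ i → cong (μ (suc k)) (trans (deg-facet i x) (cong (λ b → deg x ∸ 𝟙 b) (sym (lookup∘tabulate (λ i → lookup (X i) x) i))))) vertices ⟩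
    ∑[ i ∈ vertices ] μ (suc k) (deg x ∸ 𝟙 (lookup (memb x) i))
      ≡⟨ ∑-lookup (λ b → μ (suc k) (deg x ∸ 𝟙 b)) (memb x) ⟩
    deg x * μ (suc k) (deg x ∸ 1) + (suc (suc k) ∸ deg x) * μ (suc k) (deg x) ∎

  SA≡∑∑μ : SA X ≡ ∑[ x ∈ points ] ∑[ i ∈ vertices ] μ (suc k) (EM.deg (facet X i) x)
  SA≡∑∑μ = trans (∑-cong (λ i → Vol≡∑μ (facet X i)) vertices) (∑-comm (λ i x → μ (suc k) (EM.deg (facet X i) x)) vertices points)

theorem4p3 : (k n : ℕ) (X : Family (suc k) n) →
    2 * suc k * Vol X ≡ 2 * SA X + suc (suc k) * MedCard X
theorem4p3 k n X = begin
  2 * suc k * Vol X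
    ≡⟨ cong (2 * suc k *_) (Vol≡∑μ X) ⟩
  2 * suc k * (∑[ x ∈ points ] μ D (deg x))
    ≡⟨ ∑-*ˡ (2 * suc k) (μ D ∘ deg) points ⟨
  ∑[ x ∈ points ] 2 * suc k * μ D (deg x)
    ≡⟨ ∑-cong (λ x → trans (μ-recurrence (suc k) (deg x) (∣p∣≤n (memb x)))
                            (cong (λ s → 2 * s + D * 𝟙 (isMed x)) (sym (∑-facets-μ X x)))) points ⟩
  ∑[ x ∈ points ] (2 * facet-sum x + D * 𝟙 (isMed x))
    ≡⟨ ∑-+ (λ x → 2 * facet-sum x) (λ x → D * 𝟙 (isMed x)) points ⟩
  (∑[ x ∈ points ] 2 * facet-sum x) + (∑[ x ∈ points ] D * 𝟙 (isMed x))
    ≡⟨ cong₂ _+_ (∑-*ˡ 2 facet-sum points) (∑-*ˡ D (𝟙 ∘ isMed) points) ⟩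
  2 * (∑[ x ∈ points ] facet-sum x) + D * (∑[ x ∈ points ] 𝟙 (isMed x))
    ≡⟨ cong₂ (λ s m → 2 * s + D * m) (SA≡∑∑μ X) (length-filterᵇ isMed points) ⟨
  2 * SA X + D * MedCard X ∎
  where
  open EM X using (deg; memb; isMed)
  D : ℕ
  D = suc (suc k)
  points : List (Fin n)
  points = allFin n
  facet-sum : Fin n → ℕ
  facet-sum x = ∑[ i ∈ allFin D ] μ (suc k) (EM.deg (facet X i) x)
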